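{- Let $H_1$ and $H_2$ be disjoint graphs, let $P$ be a path with at least one vertex, disjoint from them, and let $v_1\in V(H_1)$, $v_2\in V(H_2)$. Let $G$ be the graph obtained from the disjoint union of $H_1$, $H_2$ and $P$ by identifying the first vertex of $P$ with $v_1$ and the last vertex of $P$ with $v_2$. Suppose that for $i=1,2$, $f_i:V(H_i)\to[5]^2$ is a map such that every vertex of $H_i$ other than possibly $v_i$ is satisfied in $H_i$ with respect to $f_i$. If $\left|\bigcup_{u\in N_{H_1}(v_1)} f_1(u)\right|\ge4$ and $\left|\bigcup_{u\in N_{H_2}(v_2)} f_2(u)\right|\ge3$, then $G$ is configurable.
   Context: $[5]^2$ is the set of $2$-element subsets of $\{1,2,3,4,5\}$. $N_H(v)$ is the set of neighbors of $v$ in $H$ and $N[v]$ the closed neighborhood. For a map $f:V(H)\to[5]^2$, a vertex $v$ is satisfied in $H$ if $\bigcup_{u\in N[v]} f(u)=\{1,2,3,4,5\}$ (closed neighborhood in $H$). A configuration on $G$ is a map $f:V(G)\to[5]^2$ under which every vertex of $G$ is satisfied; $G$ is configurable if it has a configuration. -}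

module Defs where

open import Data.Nat as ℕ using (ℕ; zero; suc; _≡ᵇ_)
open import Data.Fin as Fin using (Fin; toℕ)
open import Data.Fin.Subset using (Subset; ∣_∣; _∈_; ⋃; ⊥)
open import Data.List using (List; map; allFin)
open import Data.Bool using (Bool; T; if_then_else_; _∧_)
open import Data.Sum using (_⊎_; inj₁; inj₂)
open import Data.Product using (Σ; ∃; _×_; proj₁)
open import Data.Empty renaming (⊥ to Empty)
open import Relation.Nullary using (¬_; does)
open import Relation.Binary.PropositionalEquality using (_≡_)

-- [5]^2 : 2-element subsets of {1,...,5} (colours are Fin 5)
Pair5 : Set
Pair5 = Σ (Subset 5) (λ s → ∣ s ∣ ≡ 2)

record Graph : Set₁ where
  field
    V   : Set
    Adj : V → V → Set
open Graph public

Satisfied : (G : Graph) → (V G → Pair5) → V G → Set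
Satisfied G f v = (c : Fin 5) → ∃ λ u → (u ≡ v ⊎ Adj G v u) × (c ∈ proj₁ (f u))

Configurable : Graph → Set
Configurable G = ∃ λ (f : V G → Pair5) → (v : V G) → Satisfied G f v

record FinGraph : Set where
  field
    n      : ℕ
    adj    : Fin n → Fin n → Bool
    sym    : ∀ x y → adj x y ≡ adj y x
    irrefl : ∀ x → adj x x ≡ Data.Bool.false
open FinGraph public

toGraph : FinGraph → Graph
toGraph H = record { V = Fin (n H) ; Adj = λ x y → T (adj H x y) }

nbUnion : (H : FinGraph) → (Fin (n H) → Pair5) → Fin (n H) → Subset 5
nbUnion H f v = ⋃ (map (λ u → if adj H v u then proj₁ (f u) else ⊥) (allFin (n H)))

-- The glued graph G: disjoint union of H1, H2 and a path P with vertices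
-- p_0, ..., p_m (m+1 ≥ 1 vertices, edges p_i p_{i+1}), with p_0 identified
-- with v1 and p_m identified with v2 (so for m = 0, v1, p_0, v2 all become one vertex).
module Glue (H1 H2 : FinGraph) (v1 : Fin (n H1)) (v2 : Fin (n H2)) (m : ℕ) where

  U : Set
  U = Fin (n H1) ⊎ (Fin (n H2) ⊎ Fin (suc m))

  canon : U → U
  canon (inj₁ x) = inj₁ x
  canon (inj₂ (inj₁ y)) =
    if (m ≡ᵇ 0) ∧ does (y Fin.≟ v2) then inj₁ v1 else inj₂ (inj₁ y)
  canon (inj₂ (inj₂ i)) =
    if toℕ i ≡ᵇ 0 then inj₁ v1
    else (if toℕ i ≡ᵇ m then inj₂ (inj₁ v2) else inj₂ (inj₂ i))

  UAdj : U → U → Set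
  UAdj (inj₁ x) (inj₁ x') = T (adj H1 x x')
  UAdj (inj₂ (inj₁ y)) (inj₂ (inj₁ y')) = T (adj H2 y y')
  UAdj (inj₂ (inj₂ i)) (inj₂ (inj₂ j)) = (suc (toℕ i) ≡ toℕ j) ⊎ (suc (toℕ j) ≡ toℕ i)
  UAdj _ _ = Empty

  G : Graph
  G = record
    { V   = Σ U (λ x → canon x ≡ x)
    ; Adj = λ a b → ∃ λ x → ∃ λ y →
              (canon x ≡ proj₁ a) × (canon y ≡ proj₁ b) × UAdj x y
    }

glue : (H1 H2 : FinGraph) → Fin (n H1) → Fin (n H2) → ℕ → Graph
glue H1 H2 v1 v2 m = Glue.G H1 H2 v1 v2 m

-- Recolour H₁ by a permutation σ of the five colours so that f₁(v₁) becomes {0,1}; since N_{H₁}(v₁)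
-- misses at most one colour, σ can be chosen so that N_{H₁}[v₁] then misses at most the colour 2.
-- The path vertex pᵢ gets {2i, 2i+1} (mod 5): consecutive pairs are disjoint, any three consecutive
-- ones cover all colours, p₀ agrees with v₁ and p₁ supplies the colour 2. Recolour H₂ so that v₂
-- gets the pair of p_m and a neighbour of v₂ carries the colour missed by p_m and p_{m-1}; if m = 0
-- that colour is 2 and v₁ = v₂ takes it from H₂. Recolouring preserves satisfaction inside H₁ and H₂.

module Submission where

open import Defs hiding (sym)
open import Data.Nat as ℕ using (ℕ; zero; suc; pred; _≤_; s≤s; ≢-nonZero)
open import Data.Nat.Properties using (+-0-commutativeMonoid; n≢0⇒n>0; suc-pred; pred[n]≤n; ≤-trans; ≤∧≢⇒<)
open import Data.Bool using (Bool; true; false; T; if_then_else_)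
open import Data.Unit using (tt)
open import Data.Bool.Properties using () renaming (_≟_ to _≟ᵇ_)
open import Data.Fin as Fin using (Fin; toℕ; fromℕ; fromℕ<)
open import Data.Fin.Patterns using (0F; 1F; 2F; 3F; 4F)
open import Data.Fin.Properties using (all?; any?; toℕ-fromℕ; toℕ-fromℕ<; toℕ≤pred[n])
open import Data.Fin.Subset using (Subset; ∣_∣; _∈_; _⊆_; _∪_; ⊥; ⊤; ⁅_⁆; ⋃; inside; outside)
open import Data.Fin.Subset.Properties
  using (_∈?_; ⊆-antisym; ⊆-reflexive; x∈p∪q⁺; x∈p∪q⁻; ∈⊤; ∉⊥; x∈⁅x⁆; x∈⁅y⁆⇒x≡y; anySubset?)
open import Data.Fin.Permutation using (Permutation′; _⟨$⟩ʳ_; _∘ₚ_; id; transpose; permutation)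
import Data.Fin.Permutation.Components as PC
open import Data.List using (List; []; _∷_; map; allFin)
open import Data.Vec using ([]; _∷_; lookup; tabulate)
open import Data.Vec.Properties using (lookup∘tabulate; tabulate∘lookup; []=⇒lookup; lookup⇒[]=)
import Data.Vec.Properties as Vec
open import Data.Product using (∃; ∃₂; _×_; _,_; proj₁)
open import Data.Sum as Sum using (_⊎_; inj₁; inj₂)
open import Function using (_∘_; Injection)
open import Function.Properties.Inverse using (↔⇒↣)
open import Relation.Nullary using (Dec; yes; no; does; ¬_; ¬?; contradiction)
open import Relation.Nullary.Decidable using (map′; decidable-stable; from-yes; _×-dec_; _→-dec_; _⊎-dec_)
open import Relation.Binary.PropositionalEquality
  using (_≡_; _≢_; refl; sym; trans; cong; cong₂; subst; module ≡-Reasoning)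
open import Algebra.Properties.CommutativeMonoid.Sum +-0-commutativeMonoid using (sum; sum-permute; sum-cong-≗)

module _ {n : ℕ} where

  recolour : Permutation′ n → Subset n → Subset n
  recolour π p = tabulate (λ k → lookup p (π ⟨$⟩ʳ k))

  ∈-recolour⁺ : ∀ π {p : Subset n} {k} → π ⟨$⟩ʳ k ∈ p → k ∈ recolour π p
  ∈-recolour⁺ π {k = k} h = lookup⇒[]= k _ (trans (lookup∘tabulate _ k) ([]=⇒lookup h))

  ∈-recolour⁻ : ∀ π (p : Subset n) {k} → k ∈ recolour π p → π ⟨$⟩ʳ k ∈ p
  ∈-recolour⁻ π p {k} h = lookup⇒[]= _ p (trans (sym (lookup∘tabulate _ k)) ([]=⇒lookup h))

  recolour-id : (p : Subset n) → recolour id p ≡ p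
  recolour-id = tabulate∘lookup

  recolour-∘ : (π ρ : Permutation′ n) (p : Subset n) → recolour (π ∘ₚ ρ) p ≡ recolour π (recolour ρ p)
  recolour-∘ π ρ p = ⊆-antisym
    (∈-recolour⁺ π ∘ ∈-recolour⁺ ρ ∘ ∈-recolour⁻ (π ∘ₚ ρ) p)
    (∈-recolour⁺ (π ∘ₚ ρ) ∘ ∈-recolour⁻ ρ p ∘ ∈-recolour⁻ π (recolour ρ p))

  recolour-∪ : (π : Permutation′ n) (p q : Subset n) → recolour π (p ∪ q) ≡ recolour π p ∪ recolour π q
  recolour-∪ π p q = ⊆-antisym
    (x∈p∪q⁺ ∘ Sum.map (∈-recolour⁺ π) (∈-recolour⁺ π) ∘ x∈p∪q⁻ p q ∘ ∈-recolour⁻ π (p ∪ q))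
    (∈-recolour⁺ π ∘ x∈p∪q⁺ ∘ Sum.map (∈-recolour⁻ π p) (∈-recolour⁻ π q) ∘ x∈p∪q⁻ _ _)

  recolour-⊤ : (π : Permutation′ n) → recolour π ⊤ ≡ ⊤
  recolour-⊤ π = ⊆-antisym (λ _ → ∈⊤) (λ _ → ∈-recolour⁺ π ∈⊤)

  recolour-⁅⁆ : (π : Permutation′ n) {i : Fin n} {a : Fin n} → π ⟨$⟩ʳ i ≡ a → recolour π ⁅ a ⁆ ≡ ⁅ i ⁆
  recolour-⁅⁆ π {i} refl = ⊆-antisym
    (λ h → subst (_∈ ⁅ i ⁆) (sym (Injection.injective (↔⇒↣ π) (x∈⁅y⁆⇒x≡y _ (∈-recolour⁻ π _ h)))) (x∈⁅x⁆ i))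
    (λ h → ∈-recolour⁺ π (subst (λ j → π ⟨$⟩ʳ j ∈ ⁅ π ⟨$⟩ʳ i ⁆) (sym (x∈⁅y⁆⇒x≡y i h)) (x∈⁅x⁆ _)))

∣p∣≡sum : ∀ {n} (p : Subset n) → ∣ p ∣ ≡ sum (λ k → if lookup p k then 1 else 0)
∣p∣≡sum [] = refl
∣p∣≡sum (inside ∷ p) = cong suc (∣p∣≡sum p)
∣p∣≡sum (outside ∷ p) = ∣p∣≡sum p

∣recolour∣ : ∀ {n} (π : Permutation′ n) (p : Subset n) → ∣ recolour π p ∣ ≡ ∣ p ∣
∣recolour∣ {n} π p = begin
  ∣ recolour π p ∣                              ≡⟨ ∣p∣≡sum (recolour π p) ⟩
  sum (indicator ∘ lookup (recolour π p))      ≡⟨ sum-cong-≗ {n} (cong indicator ∘ lookup∘tabulate _) ⟩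
  sum (indicator ∘ lookup p ∘ (π ⟨$⟩ʳ_))        ≡⟨ sum-permute (indicator ∘ lookup p) π ⟨
  sum (indicator ∘ lookup p)                    ≡⟨ ∣p∣≡sum p ⟨
  ∣ p ∣                                         ∎
  where
  open ≡-Reasoning
  indicator : Bool → ℕ
  indicator b = if b then 1 else 0

allSubsets? : ∀ {n} {P : Subset n → Set} → ((p : Subset n) → Dec (P p)) → Dec (∀ p → P p)
allSubsets? P? = map′
  (λ ¬∃¬P p → decidable-stable (P? p) (λ ¬Pp → ¬∃¬P (p , ¬Pp)))
  (λ ∀P (p , ¬Pp) → ¬Pp (∀P p))
  (¬? (anySubset? (¬? ∘ P?)))

Colour : Set
Colour = Fin 5

_≟ˢ_ : (p q : Subset 5) → Dec (p ≡ q)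
_≟ˢ_ = Vec.≡-dec _≟ᵇ_

-- Decided by exhaustive evaluation; abstract keeps that evaluation out of the places they are used.
abstract
  ∣p∣≡2⇒doubleton : ∀ (p : Subset 5) → ∣ p ∣ ≡ 2 → ∃₂ λ a₁ a₂ → a₁ ≢ a₂ × p ≡ ⁅ a₁ ⁆ ∪ ⁅ a₂ ⁆
  ∣p∣≡2⇒doubleton = from-yes (allSubsets? {5} λ p → (∣ p ∣ ℕ.≟ 2) →-dec
    any? λ a₁ → any? λ a₂ → ¬? (a₁ Fin.≟ a₂) ×-dec (p ≟ˢ (⁅ a₁ ⁆ ∪ ⁅ a₂ ⁆)))

  4≤∣p∣⇒covered-by-triple : ∀ (p : Subset 5) a₁ a₂ → 4 ≤ ∣ p ∣ → a₁ ≢ a₂ →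
    ∃ λ a₃ → a₁ ≢ a₃ × a₂ ≢ a₃ × (p ∪ (⁅ a₁ ⁆ ∪ ⁅ a₂ ⁆)) ∪ ⁅ a₃ ⁆ ≡ ⊤
  4≤∣p∣⇒covered-by-triple = from-yes (allSubsets? {5} λ p → all? λ a₁ → all? λ a₂ →
    (4 ℕ.≤? ∣ p ∣) →-dec (¬? (a₁ Fin.≟ a₂) →-dec any? λ a₃ →
      ¬? (a₁ Fin.≟ a₃) ×-dec ¬? (a₂ Fin.≟ a₃) ×-dec (((p ∪ (⁅ a₁ ⁆ ∪ ⁅ a₂ ⁆)) ∪ ⁅ a₃ ⁆) ≟ˢ ⊤)))

  3≤∣p∣⇒third-colour : ∀ (p : Subset 5) a₁ a₂ → 3 ≤ ∣ p ∣ → ∃ λ a₃ → a₁ ≢ a₃ × a₂ ≢ a₃ × a₃ ∈ p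
  3≤∣p∣⇒third-colour = from-yes (allSubsets? {5} λ p → all? λ a₁ → all? λ a₂ →
    (3 ℕ.≤? ∣ p ∣) →-dec any? λ a₃ → ¬? (a₁ Fin.≟ a₃) ×-dec ¬? (a₂ Fin.≟ a₃) ×-dec (a₃ ∈? p))

  frame : Colour → Colour → Colour → Permutation′ 5
  frame a₁ a₂ a₃ = transpose 2F b₃ ∘ₚ transpose 1F b₂ ∘ₚ transpose 0F a₁
    where
    b₂ b₃ : Colour
    b₂ = PC.transpose 0F a₁ a₂
    b₃ = PC.transpose 1F b₂ (PC.transpose 0F a₁ a₃)

  frame-sends : ∀ a₁ a₂ a₃ → a₁ ≢ a₂ → a₁ ≢ a₃ → a₂ ≢ a₃ →
    frame a₁ a₂ a₃ ⟨$⟩ʳ 0F ≡ a₁ × frame a₁ a₂ a₃ ⟨$⟩ʳ 1F ≡ a₂ × frame a₁ a₂ a₃ ⟨$⟩ʳ 2F ≡ a₃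
  frame-sends = from-yes (all? λ a₁ → all? λ a₂ → all? λ a₃ →
    ¬? (a₁ Fin.≟ a₂) →-dec (¬? (a₁ Fin.≟ a₃) →-dec (¬? (a₂ Fin.≟ a₃) →-dec
      ((frame a₁ a₂ a₃ ⟨$⟩ʳ 0F Fin.≟ a₁) ×-dec (frame a₁ a₂ a₃ ⟨$⟩ʳ 1F Fin.≟ a₂) ×-dec
       (frame a₁ a₂ a₃ ⟨$⟩ʳ 2F Fin.≟ a₃)))))

base : Subset 5
base = ⁅ 0F ⁆ ∪ ⁅ 1F ⁆

frame-normalises : ∀ {a₁ a₂ a₃} → a₁ ≢ a₂ → a₁ ≢ a₃ → a₂ ≢ a₃ →
  recolour (frame a₁ a₂ a₃) (⁅ a₁ ⁆ ∪ ⁅ a₂ ⁆) ≡ base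
frame-normalises {a₁} {a₂} {a₃} a₁≢a₂ a₁≢a₃ a₂≢a₃ with frame-sends a₁ a₂ a₃ a₁≢a₂ a₁≢a₃ a₂≢a₃
... | sends₀ , sends₁ , _ = trans (recolour-∪ (frame a₁ a₂ a₃) ⁅ a₁ ⁆ ⁅ a₂ ⁆)
  (cong₂ _∪_ (recolour-⁅⁆ (frame a₁ a₂ a₃) sends₀) (recolour-⁅⁆ (frame a₁ a₂ a₃) sends₁))

normalise-covering : (p : Pair5) (A : Subset 5) → 4 ≤ ∣ A ∣ →
  ∃ λ σ → recolour σ (proj₁ p) ≡ base × (recolour σ A ∪ base) ∪ ⁅ 2F ⁆ ≡ ⊤
normalise-covering (p , ∣p∣≡2) A 4≤∣A∣ with ∣p∣≡2⇒doubleton p ∣p∣≡2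
... | a₁ , a₂ , a₁≢a₂ , refl with 4≤∣p∣⇒covered-by-triple A a₁ a₂ 4≤∣A∣ a₁≢a₂
... | a₃ , a₁≢a₃ , a₂≢a₃ , covered with frame-sends a₁ a₂ a₃ a₁≢a₂ a₁≢a₃ a₂≢a₃
... | _ , _ , sends₂ = σ , frame-normalises a₁≢a₂ a₁≢a₃ a₂≢a₃ , (begin
  (recolour σ A ∪ base) ∪ ⁅ 2F ⁆
    ≡⟨ cong₂ (λ q r → (recolour σ A ∪ q) ∪ r) (frame-normalises a₁≢a₂ a₁≢a₃ a₂≢a₃) (recolour-⁅⁆ σ sends₂) ⟨
  (recolour σ A ∪ recolour σ (⁅ a₁ ⁆ ∪ ⁅ a₂ ⁆)) ∪ recolour σ ⁅ a₃ ⁆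
    ≡⟨ cong (_∪ recolour σ ⁅ a₃ ⁆) (recolour-∪ σ A (⁅ a₁ ⁆ ∪ ⁅ a₂ ⁆)) ⟨
  recolour σ (A ∪ (⁅ a₁ ⁆ ∪ ⁅ a₂ ⁆)) ∪ recolour σ ⁅ a₃ ⁆
    ≡⟨ recolour-∪ σ (A ∪ (⁅ a₁ ⁆ ∪ ⁅ a₂ ⁆)) ⁅ a₃ ⁆ ⟨
  recolour σ ((A ∪ (⁅ a₁ ⁆ ∪ ⁅ a₂ ⁆)) ∪ ⁅ a₃ ⁆)
    ≡⟨ cong (recolour σ) covered ⟩
  recolour σ ⊤
    ≡⟨ recolour-⊤ σ ⟩
  ⊤ ∎)
  where
  open ≡-Reasoning
  σ = frame a₁ a₂ a₃

normalise-third : (p : Pair5) (B : Subset 5) → 3 ≤ ∣ B ∣ →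
  ∃ λ ρ → recolour ρ (proj₁ p) ≡ base × ρ ⟨$⟩ʳ 2F ∈ B
normalise-third (p , ∣p∣≡2) B 3≤∣B∣ with ∣p∣≡2⇒doubleton p ∣p∣≡2
... | b₁ , b₂ , b₁≢b₂ , refl with 3≤∣p∣⇒third-colour B b₁ b₂ 3≤∣B∣
... | b₃ , b₁≢b₃ , b₂≢b₃ , b₃∈B with frame-sends b₁ b₂ b₃ b₁≢b₂ b₁≢b₃ b₂≢b₃
... | _ , _ , sends₂ = frame b₁ b₂ b₃ , frame-normalises b₁≢b₂ b₁≢b₃ b₂≢b₃ , subst (_∈ B) (sym sends₂) b₃∈B

rotate : Permutation′ 5
rotate = permutation down up
  (λ { 0F → refl ; 1F → refl ; 2F → refl ; 3F → refl ; 4F → refl })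
  (λ { 0F → refl ; 1F → refl ; 2F → refl ; 3F → refl ; 4F → refl })
  where
  down up : Colour → Colour
  down 0F = 3F
  down 1F = 4F
  down 2F = 0F
  down 3F = 1F
  down 4F = 2F
  up 0F = 2F
  up 1F = 3F
  up 2F = 4F
  up 3F = 0F
  up 4F = 1F

-- rotate sends k to k − 2 (mod 5), hence pathColour i = {2i, 2i+1} (mod 5).
shift : ℕ → Permutation′ 5
shift zero = id
shift (suc i) = shift i ∘ₚ rotate

pathColour : ℕ → Subset 5
pathColour i = recolour (shift i) base

rotate-window : ∀ j → j ∈ base ⊎ rotate ⟨$⟩ʳ j ∈ base ⊎ rotate ⟨$⟩ʳ (rotate ⟨$⟩ʳ j) ∈ base
rotate-window = from-yes (all? λ j →
  (j ∈? base) ⊎-dec (rotate ⟨$⟩ʳ j ∈? base) ⊎-dec (rotate ⟨$⟩ʳ (rotate ⟨$⟩ʳ j) ∈? base))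

rotate-step : ∀ j → rotate ⟨$⟩ʳ j ∈ base ⊎ rotate ⟨$⟩ʳ j ≡ 2F ⊎ j ∈ base
rotate-step = from-yes (all? λ j → (rotate ⟨$⟩ʳ j ∈? base) ⊎-dec (rotate ⟨$⟩ʳ j Fin.≟ 2F) ⊎-dec (j ∈? base))

path-window : ∀ {i} → i ≢ 0 → ∀ k → k ∈ pathColour (pred i) ⊎ k ∈ pathColour i ⊎ k ∈ pathColour (suc i)
path-window {zero} i≢0 k = contradiction refl i≢0
path-window {suc i} _ k = Sum.map (∈-recolour⁺ (shift i))
  (Sum.map (∈-recolour⁺ (shift (suc i))) (∈-recolour⁺ (shift (suc (suc i)))))
  (rotate-window (shift i ⟨$⟩ʳ k))

path-step : ∀ {i} → i ≢ 0 → ∀ k → k ∈ pathColour i ⊎ shift i ⟨$⟩ʳ k ≡ 2F ⊎ k ∈ pathColour (pred i)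
path-step {zero} i≢0 k = contradiction refl i≢0
path-step {suc i} _ k = Sum.map (∈-recolour⁺ (shift (suc i))) (Sum.map₂ (∈-recolour⁺ (shift i)))
  (rotate-step (shift i ⟨$⟩ʳ k))

2∈pathColour₁ : 2F ∈ pathColour 1
2∈pathColour₁ = from-yes (2F ∈? pathColour 1)

recolourPair : Permutation′ 5 → Pair5 → Pair5
recolourPair π (p , ∣p∣≡2) = recolour π p , trans (∣recolour∣ π p) ∣p∣≡2

∈⋃-map⁻ : ∀ {A : Set} {n} (h : A → Subset n) (xs : List A) {k} → k ∈ ⋃ (map h xs) → ∃ λ x → k ∈ h x
∈⋃-map⁻ h [] k∈⋃ = contradiction k∈⋃ ∉⊥
∈⋃-map⁻ h (x ∷ xs) k∈⋃ with x∈p∪q⁻ (h x) (⋃ (map h xs)) k∈⋃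
... | inj₁ k∈hx = x , k∈hx
... | inj₂ k∈⋃′ = ∈⋃-map⁻ h xs k∈⋃′

∈-if⁻ : ∀ {n} b {p : Subset n} {k} → k ∈ (if b then p else ⊥) → T b × k ∈ p
∈-if⁻ true k∈p = tt , k∈p
∈-if⁻ false k∈⊥ = contradiction k∈⊥ ∉⊥

∈nbUnion⁻ : ∀ (H : FinGraph) f v {k} → k ∈ nbUnion H f v → ∃ λ u → T (adj H v u) × k ∈ proj₁ (f u)
∈nbUnion⁻ H f v k∈ with ∈⋃-map⁻ (λ u → if adj H v u then proj₁ (f u) else ⊥) (allFin (n H)) k∈
... | u , k∈fu = u , ∈-if⁻ (adj H v u) k∈fu

if-yes : ∀ {A : Set} {P : Set} (P? : Dec P) {x y : A} → P → (if does P? then x else y) ≡ x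
if-yes (yes _) _ = refl
if-yes (no ¬p) p = contradiction p ¬p

if-no : ∀ {A : Set} {P : Set} (P? : Dec P) {x y : A} → ¬ P → (if does P? then x else y) ≡ y
if-no (yes p) ¬p = contradiction p ¬p
if-no (no _) _ = refl

module Identification (H1 H2 : FinGraph) (v1 : Fin (n H1)) (v2 : Fin (n H2)) (m : ℕ) where

  open Glue H1 H2 v1 v2 m

  -- canon tests m ≡ᵇ n, which is definitionally does (m ℕ.≟ n); hence if-yes and if-no apply.
  canon-v2 : m ≡ 0 → canon (inj₂ (inj₁ v2)) ≡ inj₁ v1
  canon-v2 m≡0 = if-yes ((m ℕ.≟ 0) ×-dec (v2 Fin.≟ v2)) (m≡0 , refl)

  canon-H2 : ∀ {y} → ¬ (m ≡ 0 × y ≡ v2) → canon (inj₂ (inj₁ y)) ≡ inj₂ (inj₁ y)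
  canon-H2 {y} = if-no ((m ℕ.≟ 0) ×-dec (y Fin.≟ v2))

  canon-first : ∀ {i} → toℕ i ≡ 0 → canon (inj₂ (inj₂ i)) ≡ inj₁ v1
  canon-first {i} = if-yes (toℕ i ℕ.≟ 0)

  canon-last : ∀ {i} → toℕ i ≢ 0 → toℕ i ≡ m → canon (inj₂ (inj₂ i)) ≡ inj₂ (inj₁ v2)
  canon-last {i} i≢0 i≡m = trans (if-no (toℕ i ℕ.≟ 0) i≢0) (if-yes (toℕ i ℕ.≟ m) i≡m)

  canon-inner : ∀ {i} → toℕ i ≢ 0 → toℕ i ≢ m → canon (inj₂ (inj₂ i)) ≡ inj₂ (inj₂ i)
  canon-inner {i} i≢0 i≢m = trans (if-no (toℕ i ℕ.≟ 0) i≢0) (if-no (toℕ i ℕ.≟ m) i≢m)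

  into-fixed : ∀ x {z} → canon x ≡ z → canon z ≡ z → canon (canon x) ≡ canon x
  into-fixed _ refl fixed = fixed

  canon-idem : ∀ x → canon (canon x) ≡ canon x
  canon-idem (inj₁ x) = refl
  canon-idem (inj₂ (inj₁ y)) with (m ℕ.≟ 0) ×-dec (y Fin.≟ v2)
  ... | yes (m≡0 , refl) = into-fixed (inj₂ (inj₁ v2)) (canon-v2 m≡0) refl
  ... | no ¬merged = into-fixed (inj₂ (inj₁ y)) (canon-H2 ¬merged) (canon-H2 ¬merged)
  canon-idem (inj₂ (inj₂ i)) with toℕ i ℕ.≟ 0 | toℕ i ℕ.≟ m
  ... | yes i≡0 | _ = into-fixed (inj₂ (inj₂ i)) (canon-first i≡0) refl
  ... | no i≢0 | yes i≡m = into-fixed (inj₂ (inj₂ i)) (canon-last i≢0 i≡m)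
          (canon-H2 (λ (m≡0 , _) → i≢0 (trans i≡m m≡0)))
  ... | no i≢0 | no i≢m = into-fixed (inj₂ (inj₂ i)) (canon-inner i≢0 i≢m) (canon-inner i≢0 i≢m)

  vertex : U → V G
  vertex x = canon x , canon-idem x

module Configuration
  (H1 H2 : FinGraph) (v1 : Fin (n H1)) (v2 : Fin (n H2)) (m : ℕ)
  (f1 : Fin (n H1) → Pair5) (f2 : Fin (n H2) → Pair5)
  (s1 : (x : Fin (n H1)) → x ≢ v1 → Satisfied (toGraph H1) f1 x)
  (s2 : (y : Fin (n H2)) → y ≢ v2 → Satisfied (toGraph H2) f2 y)
  (σ ρ : Permutation′ 5)
  (σ-normalises : recolour σ (proj₁ (f1 v1)) ≡ base)
  (σ-covers : (recolour σ (nbUnion H1 f1 v1) ∪ base) ∪ ⁅ 2F ⁆ ≡ ⊤)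
  (ρ-normalises : recolour ρ (proj₁ (f2 v2)) ≡ base)
  (ρ-third : ρ ⟨$⟩ʳ 2F ∈ nbUnion H2 f2 v2)
  where

  open Glue H1 H2 v1 v2 m
  open Identification H1 H2 v1 v2 m

  τ : Permutation′ 5
  τ = shift m ∘ₚ ρ

  colour : U → Pair5
  colour (inj₁ x) = recolourPair σ (f1 x)
  colour (inj₂ (inj₁ y)) = recolourPair τ (f2 y)
  colour (inj₂ (inj₂ i)) = recolourPair (shift (toℕ i)) (base , refl)

  colour-v1 : proj₁ (colour (inj₁ v1)) ≡ base
  colour-v1 = σ-normalises

  colour-v2 : proj₁ (colour (inj₂ (inj₁ v2))) ≡ pathColour m
  colour-v2 = trans (recolour-∘ (shift m) ρ (proj₁ (f2 v2))) (cong (recolour (shift m)) ρ-normalises)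

  path-to-v1 : ∀ {t} → t ≡ 0 → pathColour t ≡ proj₁ (colour (inj₁ v1))
  path-to-v1 refl = trans (recolour-id base) (sym colour-v1)

  colour-canon-via : ∀ x {z} → canon x ≡ z → proj₁ (colour x) ≡ proj₁ (colour z) →
    proj₁ (colour x) ⊆ proj₁ (colour (canon x))
  colour-canon-via _ refl same = ⊆-reflexive same

  colour-canon : ∀ x → proj₁ (colour x) ⊆ proj₁ (colour (canon x))
  colour-canon (inj₁ x) c∈ = c∈
  colour-canon (inj₂ (inj₁ y)) with (m ℕ.≟ 0) ×-dec (y Fin.≟ v2)
  ... | yes (m≡0 , refl) = colour-canon-via (inj₂ (inj₁ v2)) (canon-v2 m≡0) (trans colour-v2 (path-to-v1 m≡0))
  ... | no ¬merged = colour-canon-via (inj₂ (inj₁ y)) (canon-H2 ¬merged) refl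
  colour-canon (inj₂ (inj₂ i)) with toℕ i ℕ.≟ 0 | toℕ i ℕ.≟ m
  ... | yes i≡0 | _ = colour-canon-via (inj₂ (inj₂ i)) (canon-first i≡0) (path-to-v1 i≡0)
  ... | no i≢0 | yes i≡m = colour-canon-via (inj₂ (inj₂ i)) (canon-last i≢0 i≡m)
          (trans (cong pathColour i≡m) (sym colour-v2))
  ... | no i≢0 | no i≢m = colour-canon-via (inj₂ (inj₂ i)) (canon-inner i≢0 i≢m) refl

  F : V G → Pair5
  F a = colour (proj₁ a)

  Sees : V G → Colour → Set
  Sees a c = ∃ λ u → (u ≡ a ⊎ Adj G a u) × c ∈ proj₁ (F u)

  sees-own : ∀ {a c} → c ∈ proj₁ (F a) → Sees a c
  sees-own c∈ = _ , inj₁ refl , c∈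

  sees-neighbour : ∀ {a c} x y → canon x ≡ proj₁ a → UAdj x y → c ∈ proj₁ (colour y) → Sees a c
  sees-neighbour x y x↦a x~y c∈ = vertex y , inj₂ (x , y , x↦a , refl , x~y) , colour-canon y c∈

  sees-path : ∀ {a c} x t → t ≤ m → canon x ≡ proj₁ a →
    (∀ {j : Fin (suc m)} → toℕ j ≡ t → UAdj x (inj₂ (inj₂ j))) → c ∈ pathColour t → Sees a c
  sees-path x t t≤m x↦a x~ c∈ with fromℕ< (s≤s t≤m) | toℕ-fromℕ< (s≤s t≤m)
  ... | j | refl = sees-neighbour x (inj₂ (inj₂ j)) x↦a (x~ refl) c∈

  satisfied-H1 : ∀ x e → x ≢ v1 → Satisfied G F (inj₁ x , e)
  satisfied-H1 x e x≢v1 c with s1 x x≢v1 (σ ⟨$⟩ʳ c)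
  ... | _ , inj₁ refl , h = sees-own (∈-recolour⁺ σ h)
  ... | u , inj₂ x~u , h = sees-neighbour (inj₁ x) (inj₁ u) e x~u (∈-recolour⁺ σ h)

  satisfied-H2 : ∀ y e → y ≢ v2 → Satisfied G F (inj₂ (inj₁ y) , e)
  satisfied-H2 y e y≢v2 c with s2 y y≢v2 (τ ⟨$⟩ʳ c)
  ... | _ , inj₁ refl , h = sees-own (∈-recolour⁺ τ h)
  ... | u , inj₂ y~u , h = sees-neighbour (inj₂ (inj₁ y)) (inj₂ (inj₁ u)) e y~u (∈-recolour⁺ τ h)

  sees-v2-third : ∀ {a c} → canon (inj₂ (inj₁ v2)) ≡ proj₁ a → shift m ⟨$⟩ʳ c ≡ 2F → Sees a c
  sees-v2-third v2↦a c↦2 with ∈nbUnion⁻ H2 f2 v2 ρ-third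
  ... | u , v2~u , h = sees-neighbour (inj₂ (inj₁ v2)) (inj₂ (inj₁ u)) v2↦a v2~u
          (∈-recolour⁺ τ (subst (λ j → ρ ⟨$⟩ʳ j ∈ proj₁ (f2 u)) (sym c↦2) h))

  v1-sees-2 : ∀ e → Sees (inj₁ v1 , e) 2F
  v1-sees-2 e with m ℕ.≟ 0
  ... | yes m≡0 = sees-v2-third (canon-v2 m≡0) (cong (λ t → shift t ⟨$⟩ʳ 2F) m≡0)
  ... | no m≢0 = sees-path (inj₂ (inj₂ 0F)) 1 (n≢0⇒n>0 m≢0) refl (λ j≡1 → inj₁ (sym j≡1)) 2∈pathColour₁

  satisfied-v1 : ∀ e → Satisfied G F (inj₁ v1 , e)
  satisfied-v1 e c with x∈p∪q⁻ _ _ (subst (c ∈_) (sym σ-covers) ∈⊤)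
  ... | inj₂ c∈⁅2⁆ = subst (Sees (inj₁ v1 , e)) (sym (x∈⁅y⁆⇒x≡y 2F c∈⁅2⁆)) (v1-sees-2 e)
  ... | inj₁ c∈ with x∈p∪q⁻ _ _ c∈
  ...   | inj₂ c∈base = sees-own (subst (c ∈_) (sym colour-v1) c∈base)
  ...   | inj₁ c∈σA with ∈nbUnion⁻ H1 f1 v1 (∈-recolour⁻ σ _ c∈σA)
  ...     | u , v1~u , h = sees-neighbour (inj₁ v1) (inj₁ u) e v1~u (∈-recolour⁺ σ h)

  satisfied-v2 : ∀ e → m ≢ 0 → Satisfied G F (inj₂ (inj₁ v2) , e)
  satisfied-v2 e m≢0 c with path-step m≢0 c
  ... | inj₁ c∈last = sees-own (subst (c ∈_) (sym colour-v2) c∈last)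
  ... | inj₂ (inj₁ c↦2) = sees-v2-third e c↦2
  ... | inj₂ (inj₂ c∈prev) = sees-path (inj₂ (inj₂ (fromℕ m))) (pred m) pred[n]≤n
          (canon-last (λ m≡0 → m≢0 (trans (sym (toℕ-fromℕ m)) m≡0)) (toℕ-fromℕ m))
          (λ j≡m-1 → inj₂ (trans (cong suc j≡m-1) (trans (suc-pred m {{≢-nonZero m≢0}}) (sym (toℕ-fromℕ m)))))
          c∈prev

  satisfied-inner : ∀ i e → toℕ i ≢ 0 → toℕ i ≢ m → Satisfied G F (inj₂ (inj₂ i) , e)
  satisfied-inner i e i≢0 i≢m c with path-window i≢0 c
  ... | inj₁ c∈prev = sees-path (inj₂ (inj₂ i)) (pred (toℕ i)) (≤-trans pred[n]≤n (toℕ≤pred[n] i)) e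
          (λ j≡i-1 → inj₂ (trans (cong suc j≡i-1) (suc-pred (toℕ i) {{≢-nonZero i≢0}}))) c∈prev
  ... | inj₂ (inj₁ c∈own) = sees-own c∈own
  ... | inj₂ (inj₂ c∈next) = sees-path (inj₂ (inj₂ i)) (suc (toℕ i)) (≤∧≢⇒< (toℕ≤pred[n] i) i≢m) e
          (λ j≡i+1 → inj₁ (sym j≡i+1)) c∈next

  satisfied : (a : V G) → Satisfied G F a
  satisfied (inj₁ x , e) with x Fin.≟ v1
  ... | yes refl = satisfied-v1 e
  ... | no x≢v1 = satisfied-H1 x e x≢v1
  satisfied (inj₂ (inj₁ y) , e) = satisfied-side₂ (y Fin.≟ v2) (m ℕ.≟ 0)
    where
    satisfied-side₂ : Dec (y ≡ v2) → Dec (m ≡ 0) → Satisfied G F (inj₂ (inj₁ y) , e)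
    satisfied-side₂ (no y≢v2) _ = satisfied-H2 y e y≢v2
    satisfied-side₂ (yes refl) (yes m≡0) = contradiction (trans (sym (canon-v2 m≡0)) e) λ ()
    satisfied-side₂ (yes refl) (no m≢0) = satisfied-v2 e m≢0
  satisfied (inj₂ (inj₂ i) , e) with toℕ i ℕ.≟ 0 | toℕ i ℕ.≟ m
  ... | yes i≡0 | _ = contradiction (trans (sym (canon-first i≡0)) e) λ ()
  ... | no i≢0 | yes i≡m = contradiction (trans (sym (canon-last i≢0 i≡m)) e) λ ()
  ... | no i≢0 | no i≢m = satisfied-inner i e i≢0 i≢m

  configurable : Configurable G
  configurable = F , satisfied

lemma3p2 : (H1 H2 : FinGraph) (v1 : Fin (n H1)) (v2 : Fin (n H2)) (m : ℕ)
    (f1 : Fin (n H1) → Pair5) (f2 : Fin (n H2) → Pair5) →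
    ((x : Fin (n H1)) → x ≢ v1 → Satisfied (toGraph H1) f1 x) →
    ((y : Fin (n H2)) → y ≢ v2 → Satisfied (toGraph H2) f2 y) →
    4 ≤ ∣ nbUnion H1 f1 v1 ∣ →
    3 ≤ ∣ nbUnion H2 f2 v2 ∣ →
    Configurable (glue H1 H2 v1 v2 m)
lemma3p2 H1 H2 v1 v2 m f1 f2 s1 s2 4≤∣N₁∣ 3≤∣N₂∣
  with normalise-covering (f1 v1) (nbUnion H1 f1 v1) 4≤∣N₁∣
     | normalise-third (f2 v2) (nbUnion H2 f2 v2) 3≤∣N₂∣
... | σ , σ-normalises , σ-covers | ρ , ρ-normalises , ρ-third =
  Configuration.configurable H1 H2 v1 v2 m f1 f2 s1 s2 σ ρ σ-normalises σ-covers ρ-normalises ρ-third
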